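{- Let $k$ be a positive integer. There is a constant $C_k > 0$, depending only on $k$, such that for every real number $\theta$ and every positive integer $N$ there exist integers $a_1, \dots, a_k$ and $q_1, \dots, q_k$ with $1 \le q_1, \dots, q_k \le N$ such that \[ \left| \frac{a_1}{q_1} + \dots + \frac{a_k}{q_k} - \theta \right| \le C_k N^{ -k}. \] -}

module Defs where

open import Data.Nat using (ℕ; zero; suc)
open import Data.Integer using (ℤ; +_)
open import Data.Fin using (Fin; zero; suc)
open import Data.Rational using (ℚ; _/_; 0ℚ; _+_; _-_; ∣_∣; _≤_)

-- a / q as a rational; the value at q = 0 is junk (0) and never used
-- in the statement, where q ≥ 1 is always assumed.
frac : ℤ → ℕ → ℚ
frac a zero    = 0ℚ
frac a (suc m) = a / suc m

inv-suc : ℕ → ℚ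
inv-suc n = + 1 / suc n

sumℚ : (k : ℕ) → (Fin k → ℚ) → ℚ
sumℚ zero    f = 0ℚ
sumℚ (suc k) f = f zero + sumℚ k (λ i → f (suc i))

-- Real numbers (Bishop): regular Cauchy sequences of rationals,
-- |x m - x n| ≤ 1/(m+1) + 1/(n+1).
record ℝ : Set where
  field
    seq : ℕ → ℚ
    reg : ∀ m n → ∣ seq m - seq n ∣ ≤ inv-suc m + inv-suc n
open ℝ public

-- |r - θ| ≤ c for rationals r, c and a real θ (Bishop's order):
-- for every n, |r - θ_n| ≤ c + 1/(n+1).
DistLe : ℚ → ℝ → ℚ → Set
DistLe r θ c = ∀ n → ∣ r - seq θ n ∣ ≤ c + inv-suc n

{-# OPTIONS --safe #-}
module Submission where

-- Take the k moduli qᵢ = 1 + i m (1 ≤ i ≤ k) with k! ∣ m. They are pairwise coprime,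
-- so by Bézout every fraction p / ∏ qᵢ splits into partial fractions Σ aᵢ / qᵢ.
-- Choosing m as large as qᵢ ≤ N allows gives N ≤ K qᵢ with K = k · k!, hence
-- Q = ∏ qᵢ ≥ (N / K)ᵏ, and rounding θ to a fraction p / Q costs at most 2 / Q ≤ 2 Kᵏ N⁻ᵏ.

open import Defs
open import Data.Nat.Base as ℕ using (ℕ; zero; suc; NonZero; _!; _^_; s≤s; z≤n)
  renaming (_≤_ to _≤ℕ_; _<_ to _<ℕ_)
import Data.Nat.Properties as ℕ
open import Data.Nat.Coprimality using (Coprime; coprime-divisor; coprime-Bézout)
open import Data.Nat.DivMod using (_/_; _%_; m/n*n≤m; m≡m%n+[m/n]*n; m%n<n)
open import Data.Nat.Divisibility using (_∣_; ∣-trans; ∣1⇒≡1; ∣m+n∣m⇒∣n; ∣n⇒∣m*n; m∣m*n; m≤n⇒m!∣n!)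
open import Data.Nat.GCD using (module Bézout)
import Data.Nat.Tactic.RingSolver as ℕ-Ring
open import Data.Integer.Base as ℤ using (ℤ; +_; 1ℤ)
import Data.Integer.Properties as ℤ
open import Data.Integer.DivMod using (_/ℕ_; [n/ℕd]*d≤n; n<s[n/ℕd]*d)
import Data.Integer.Tactic.RingSolver as ℤ-Ring
open import Data.Rational.Base using (ℚ; 0ℚ; _+_; _-_; -_; _*_; _≤_; _<_; ∣_∣; ↥_; ↧ₙ_; fromℚᵘ; toℚᵘ)
import Data.Rational.Properties as ℚ
open import Data.Rational.Solver using (module +-*-Solver)
open import Data.Rational.Unnormalised.Base as ℚᵘ using (mkℚᵘ; *≡*; *≤*)
import Data.Rational.Unnormalised.Properties as ℚᵘ
open import Data.Fin.Base using (Fin; zero; suc; toℕ) renaming (_<_ to _<ᶠ_)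
open import Data.Fin.Properties using (toℕ<n)
open import Data.Vec.Functional using (foldr; tail; _∷_)
open import Data.Product using (Σ; ∃; ∃₂; _×_; _,_)
open import Function using (_∘_)
open import Relation.Binary.PropositionalEquality

fromℚᵘ-homo-+ : ∀ x y → fromℚᵘ (x ℚᵘ.+ y) ≡ fromℚᵘ x + fromℚᵘ y
fromℚᵘ-homo-+ x y = ℚ.toℚᵘ-injective (begin
  toℚᵘ (fromℚᵘ (x ℚᵘ.+ y))                ≈⟨ ℚ.toℚᵘ-fromℚᵘ (x ℚᵘ.+ y) ⟩
  x ℚᵘ.+ y                                ≈⟨ ℚᵘ.+-cong (ℚ.toℚᵘ-fromℚᵘ x) (ℚ.toℚᵘ-fromℚᵘ y) ⟨
  toℚᵘ (fromℚᵘ x) ℚᵘ.+ toℚᵘ (fromℚᵘ y)    ≈⟨ ℚ.toℚᵘ-homo-+ (fromℚᵘ x) (fromℚᵘ y) ⟨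
  toℚᵘ (fromℚᵘ x + fromℚᵘ y)              ∎)
  where open ℚᵘ.≃-Reasoning

fromℚᵘ-homo-* : ∀ x y → fromℚᵘ (x ℚᵘ.* y) ≡ fromℚᵘ x * fromℚᵘ y
fromℚᵘ-homo-* x y = ℚ.toℚᵘ-injective (begin
  toℚᵘ (fromℚᵘ (x ℚᵘ.* y))                ≈⟨ ℚ.toℚᵘ-fromℚᵘ (x ℚᵘ.* y) ⟩
  x ℚᵘ.* y                                ≈⟨ ℚᵘ.*-cong (ℚ.toℚᵘ-fromℚᵘ x) (ℚ.toℚᵘ-fromℚᵘ y) ⟨
  toℚᵘ (fromℚᵘ x) ℚᵘ.* toℚᵘ (fromℚᵘ y)    ≈⟨ ℚ.toℚᵘ-homo-* (fromℚᵘ x) (fromℚᵘ y) ⟨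
  toℚᵘ (fromℚᵘ x * fromℚᵘ y)              ∎)
  where open ℚᵘ.≃-Reasoning

fromℚᵘ-mono-≤ : ∀ {x y} → x ℚᵘ.≤ y → fromℚᵘ x ≤ fromℚᵘ y
fromℚᵘ-mono-≤ {x} {y} x≤y = ℚ.toℚᵘ-cancel-≤ (begin
  toℚᵘ (fromℚᵘ x) ≃⟨ ℚ.toℚᵘ-fromℚᵘ x ⟩
  x               ≤⟨ x≤y ⟩
  y               ≃⟨ ℚ.toℚᵘ-fromℚᵘ y ⟨
  toℚᵘ (fromℚᵘ y) ∎)
  where open ℚᵘ.≤-Reasoning

frac-+ : ∀ a b m n .{{_ : NonZero m}} .{{_ : NonZero n}} →
         frac a m + frac b n ≡ frac (a ℤ.* + n ℤ.+ b ℤ.* + m) (m ℕ.* n)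
frac-+ a b (suc m) (suc n) = sym (fromℚᵘ-homo-+ (mkℚᵘ a m) (mkℚᵘ b n))

frac-* : ∀ a b m n .{{_ : NonZero m}} .{{_ : NonZero n}} →
         frac a m * frac b n ≡ frac (a ℤ.* b) (m ℕ.* n)
frac-* a b (suc m) (suc n) = sym (fromℚᵘ-homo-* (mkℚᵘ a m) (mkℚᵘ b n))

frac-cong : ∀ a b m n .{{_ : NonZero m}} .{{_ : NonZero n}} →
            a ℤ.* + n ≡ b ℤ.* + m → frac a m ≡ frac b n
frac-cong a b (suc m) (suc n) eq = ℚ.fromℚᵘ-cong {mkℚᵘ a m} {mkℚᵘ b n} (*≡* eq)

frac-mono-≤ : ∀ a b m n .{{_ : NonZero m}} .{{_ : NonZero n}} →
              a ℤ.* + n ℤ.≤ b ℤ.* + m → frac a m ≤ frac b n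
frac-mono-≤ a b (suc m) (suc n) le = fromℚᵘ-mono-≤ {mkℚᵘ a m} {mkℚᵘ b n} (*≤* le)

frac-pos : ∀ a n .{{_ : NonZero a}} .{{_ : NonZero n}} → 0ℚ < frac (+ a) n
frac-pos (suc a) (suc n) = ℚ.positive⁻¹ _ {{ℚ.normalize-pos (suc a) (suc n)}}

frac-+-same : ∀ a b n .{{_ : NonZero n}} → frac a n + frac b n ≡ frac (a ℤ.+ b) n
frac-+-same a b n = trans (frac-+ a b n n) (frac-cong _ _ (n ℕ.* n) n (begin
  (a ℤ.* + n ℤ.+ b ℤ.* + n) ℤ.* + n   ≡⟨ distrib a b (+ n) ⟩
  (a ℤ.+ b) ℤ.* (+ n ℤ.* + n)         ≡⟨ cong ((a ℤ.+ b) ℤ.*_) (ℤ.pos-* n n) ⟨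
  (a ℤ.+ b) ℤ.* + (n ℕ.* n)           ∎))
  where
  instance
    n*n≢0 : NonZero (n ℕ.* n)
    n*n≢0 = ℕ.m*n≢0 n n
  open ≡-Reasoning
  distrib : ∀ a b c → (a ℤ.* c ℤ.+ b ℤ.* c) ℤ.* c ≡ (a ℤ.+ b) ℤ.* (c ℤ.* c)
  distrib = ℤ-Ring.solve-∀

P≤cQ⇒a/Q≤ac*1/P : ∀ a c {P Q} .{{_ : NonZero P}} .{{_ : NonZero Q}} → P ≤ℕ c ℕ.* Q →
                  frac (+ a) Q ≤ frac (+ (a ℕ.* c)) 1 * frac 1ℤ P
P≤cQ⇒a/Q≤ac*1/P a c {P} {Q} P≤cQ = begin
  frac (+ a) Q                              ≤⟨ frac-mono-≤ (+ a) (+ (a ℕ.* c)) Q P cross ⟩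
  frac (+ (a ℕ.* c)) P                      ≡⟨ cong₂ frac (ℤ.*-identityʳ (+ (a ℕ.* c))) (ℕ.*-identityˡ P) ⟨
  frac (+ (a ℕ.* c) ℤ.* 1ℤ) (1 ℕ.* P)       ≡⟨ frac-* (+ (a ℕ.* c)) 1ℤ 1 P ⟨
  frac (+ (a ℕ.* c)) 1 * frac 1ℤ P          ∎
  where
  open ℚ.≤-Reasoning
  cross : + a ℤ.* + P ℤ.≤ + (a ℕ.* c) ℤ.* + Q
  cross = subst₂ ℤ._≤_ (ℤ.pos-* a P) (trans (cong +_ (sym (ℕ.*-assoc a c Q))) (ℤ.pos-* (a ℕ.* c) Q))
            (ℤ.+≤+ (ℕ.*-monoʳ-≤ a P≤cQ))

floor-frac : ∀ r n .{{_ : NonZero n}} → ∃ λ p → frac p n ≤ r × r ≤ frac p n + frac 1ℤ n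
floor-frac r n = p , lower , upper
  where
  open ℚ.≤-Reasoning
  p : ℤ
  p = (↥ r ℤ.* + n) /ℕ ↧ₙ r
  lower : frac p n ≤ r
  lower = begin
    frac p n               ≤⟨ frac-mono-≤ p (↥ r) n (↧ₙ r) ([n/ℕd]*d≤n (↥ r ℤ.* + n) (↧ₙ r)) ⟩
    frac (↥ r) (↧ₙ r)      ≡⟨ ℚ.↥p/↧p≡p r ⟩
    r                      ∎
  upper : r ≤ frac p n + frac 1ℤ n
  upper = begin
    r                      ≡⟨ ℚ.↥p/↧p≡p r ⟨
    frac (↥ r) (↧ₙ r)      ≤⟨ frac-mono-≤ (↥ r) (1ℤ ℤ.+ p) (↧ₙ r) n (ℤ.<⇒≤ (n<s[n/ℕd]*d (↥ r ℤ.* + n) (↧ₙ r))) ⟩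
    frac (1ℤ ℤ.+ p) n      ≡⟨ frac-+-same 1ℤ p n ⟨
    frac 1ℤ n + frac p n   ≡⟨ ℚ.+-comm (frac 1ℤ n) (frac p n) ⟩
    frac p n + frac 1ℤ n   ∎

p≤q≤p+r⇒∣p-q∣≤r : ∀ {p q r} → p ≤ q → q ≤ p + r → ∣ p - q ∣ ≤ r
p≤q≤p+r⇒∣p-q∣≤r {p} {q} {r} p≤q q≤p+r = begin
  ∣ p - q ∣        ≡⟨ cong ∣_∣ (neg-diff p q) ⟩
  ∣ - (q - p) ∣    ≡⟨ ℚ.∣-p∣≡∣p∣ (q - p) ⟩
  ∣ q - p ∣        ≡⟨ ℚ.0≤p⇒∣p∣≡p (subst (_≤ q - p) (ℚ.+-inverseʳ p) (ℚ.+-monoˡ-≤ (- p) p≤q)) ⟩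
  q - p            ≤⟨ ℚ.+-monoˡ-≤ (- p) q≤p+r ⟩
  (p + r) - p      ≡⟨ cancel p r ⟩
  r                ∎
  where
  open ℚ.≤-Reasoning
  open +-*-Solver
  neg-diff : ∀ p q → p - q ≡ - (q - p)
  neg-diff = solve 2 (λ p q → p :- q := :- (q :- p)) refl
  cancel : ∀ p r → (p + r) - p ≡ r
  cancel = solve 2 (λ p r → (p :+ r) :- p := r) refl

∣p-r∣≤∣p-q∣+∣q-r∣ : ∀ p q r → ∣ p - r ∣ ≤ ∣ p - q ∣ + ∣ q - r ∣
∣p-r∣≤∣p-q∣+∣q-r∣ p q r = subst (λ x → ∣ x ∣ ≤ ∣ p - q ∣ + ∣ q - r ∣) (split p q r) (ℚ.∣p+q∣≤∣p∣+∣q∣ (p - q) (q - r))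
  where
  open +-*-Solver
  split : ∀ p q r → (p - q) + (q - r) ≡ p - r
  split = solve 3 (λ p q r → (p :- q) :+ (q :- r) := p :- r) refl

DistLe-mono : ∀ {S θ ε ε′} → ε ≤ ε′ → DistLe S θ ε → DistLe S θ ε′
DistLe-mono ε≤ε′ dist n = ℚ.≤-trans (dist n) (ℚ.+-monoˡ-≤ (inv-suc n) ε≤ε′)

DistLe-via-seq : ∀ {S δ} θ m → ∣ S - seq θ m ∣ ≤ δ → DistLe S θ (δ + inv-suc m)
DistLe-via-seq {S} {δ} θ m close n = begin
  ∣ S - seq θ n ∣                             ≤⟨ ∣p-r∣≤∣p-q∣+∣q-r∣ S (seq θ m) (seq θ n) ⟩
  ∣ S - seq θ m ∣ + ∣ seq θ m - seq θ n ∣     ≤⟨ ℚ.+-mono-≤ close (reg θ m n) ⟩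
  δ + (inv-suc m + inv-suc n)                 ≡⟨ ℚ.+-assoc δ (inv-suc m) (inv-suc n) ⟨
  δ + inv-suc m + inv-suc n                   ∎
  where open ℚ.≤-Reasoning

-- Sampling θ at index Q - 1 makes its regularity error 1/Q as well.
approx-by-frac : ∀ (θ : ℝ) Q .{{_ : NonZero Q}} → ∃ λ p → DistLe (frac p Q) θ (frac (+ 2) Q)
approx-by-frac θ Q@(suc Q′) with floor-frac (seq θ Q′) Q
... | p , p/Q≤θ , θ≤p/Q+1/Q = p , subst (DistLe (frac p Q) θ) (frac-+-same 1ℤ 1ℤ Q)
  (DistLe-via-seq {frac p Q} θ Q′ (p≤q≤p+r⇒∣p-q∣≤r p/Q≤θ θ≤p/Q+1/Q))

∏ : ∀ {k} → (Fin k → ℕ) → ℕ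
∏ = foldr ℕ._*_ 1

∏-nonZero : ∀ {k} (q : Fin k → ℕ) → (∀ i → NonZero (q i)) → NonZero (∏ q)
∏-nonZero {zero}  q q≢0 = _
∏-nonZero {suc k} q q≢0 = ℕ.m*n≢0 (q zero) (∏ (tail q)) {{q≢0 zero}} {{∏-nonZero (tail q) (q≢0 ∘ suc)}}

n^k≤c^k*∏q : ∀ {k n c} (q : Fin k → ℕ) → (∀ i → n ≤ℕ c ℕ.* q i) → n ^ k ≤ℕ c ^ k ℕ.* ∏ q
n^k≤c^k*∏q {zero}          q n≤cq = ℕ.≤-refl
n^k≤c^k*∏q {suc k} {n} {c} q n≤cq = begin
  n ℕ.* n ^ k                                 ≤⟨ ℕ.*-mono-≤ (n≤cq zero) (n^k≤c^k*∏q (tail q) (n≤cq ∘ suc)) ⟩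
  (c ℕ.* q zero) ℕ.* (c ^ k ℕ.* ∏ (tail q))   ≡⟨ interchange c (q zero) (c ^ k) (∏ (tail q)) ⟩
  (c ℕ.* c ^ k) ℕ.* (q zero ℕ.* ∏ (tail q))   ∎
  where
  open ℕ.≤-Reasoning
  interchange : ∀ a b c d → (a ℕ.* b) ℕ.* (c ℕ.* d) ≡ (a ℕ.* c) ℕ.* (b ℕ.* d)
  interchange = ℕ-Ring.solve-∀

coprime-* : ∀ {m n o} → Coprime m n → Coprime m o → Coprime m (n ℕ.* o)
coprime-* {m} {n} m⊥n m⊥o (d∣m , d∣no) = m⊥o (d∣m , coprime-divisor d⊥n d∣no)
  where
  d⊥n : Coprime _ n
  d⊥n (e∣d , e∣n) = m⊥n (∣-trans e∣d d∣m , e∣n)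

coprime-∏ : ∀ {k m} (q : Fin k → ℕ) → (∀ i → Coprime m (q i)) → Coprime m (∏ q)
coprime-∏ {zero}  q _     (_ , d∣1) = ∣1⇒≡1 d∣1
coprime-∏ {suc k} q m⊥q = coprime-* (m⊥q zero) (coprime-∏ (tail q) (m⊥q ∘ suc))

bézout-ℕ⇒ℤ : ∀ {x a y b} → 1 ℕ.+ y ℕ.* b ≡ x ℕ.* a → + x ℤ.* + a ℤ.+ ℤ.- + y ℤ.* + b ≡ 1ℤ
bézout-ℕ⇒ℤ {x} {a} {y} {b} eq = begin
  + x ℤ.* + a ℤ.+ ℤ.- + y ℤ.* + b           ≡⟨ cong (ℤ._+ ℤ.- + y ℤ.* + b) (ℤ.pos-* x a) ⟨
  + (x ℕ.* a) ℤ.+ ℤ.- + y ℤ.* + b           ≡⟨ cong (λ t → + t ℤ.+ ℤ.- + y ℤ.* + b) eq ⟨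
  + (1 ℕ.+ y ℕ.* b) ℤ.+ ℤ.- + y ℤ.* + b     ≡⟨ cong (λ t → 1ℤ ℤ.+ t ℤ.+ ℤ.- + y ℤ.* + b) (ℤ.pos-* y b) ⟩
  1ℤ ℤ.+ + y ℤ.* + b ℤ.+ ℤ.- + y ℤ.* + b    ≡⟨ cancel (+ y) (+ b) ⟩
  1ℤ                                        ∎
  where
  open ≡-Reasoning
  cancel : ∀ y b → 1ℤ ℤ.+ y ℤ.* b ℤ.+ ℤ.- y ℤ.* b ≡ 1ℤ
  cancel = ℤ-Ring.solve-∀

coprime⇒bézout : ∀ {m n} → Coprime m n → ∃₂ λ u v → u ℤ.* + m ℤ.+ v ℤ.* + n ≡ 1ℤ
coprime⇒bézout {m} {n} m⊥n with coprime-Bézout m⊥n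
... | Bézout.+- x y eq = + x , ℤ.- + y , bézout-ℕ⇒ℤ {x} {m} {y} {n} eq
... | Bézout.-+ x y eq = ℤ.- + x , + y ,
  trans (ℤ.+-comm (ℤ.- + x ℤ.* + m) (+ y ℤ.* + n)) (bézout-ℕ⇒ℤ {y} {n} {x} {m} eq)

partial-fractions : ∀ k (q : Fin (suc k) → ℕ) (q≢0 : ∀ i → NonZero (q i)) →
                    (∀ {i j} → i <ᶠ j → Coprime (q i) (q j)) → ∀ p →
                    ∃ λ (a : Fin (suc k) → ℤ) → sumℚ (suc k) (λ i → frac (a i) (q i)) ≡ frac p (∏ q)
partial-fractions zero q q≢0 _ p = (λ _ → p) , (begin
  frac p (q zero) + 0ℚ      ≡⟨ ℚ.+-identityʳ (frac p (q zero)) ⟩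
  frac p (q zero)           ≡⟨ cong (frac p) (ℕ.*-identityʳ (q zero)) ⟨
  frac p (q zero ℕ.* 1)     ∎)
  where open ≡-Reasoning
partial-fractions (suc k) q q≢0 q⊥q p
  with coprime⇒bézout (coprime-∏ (tail q) (λ j → q⊥q {zero} {suc j} (s≤s z≤n)))
... | u , v , bézout
  with partial-fractions k (tail q) (q≢0 ∘ suc) (λ i<j → q⊥q (s≤s i<j)) (p ℤ.* u)
... | a , sum≡ = (p ℤ.* v) ∷ a , (begin
  frac (p ℤ.* v) q₀ + sumℚ (suc k) (λ i → frac (a i) (q (suc i)))   ≡⟨ cong (λ s → frac (p ℤ.* v) q₀ + s) sum≡ ⟩
  frac (p ℤ.* v) q₀ + frac (p ℤ.* u) R                               ≡⟨ frac-+ (p ℤ.* v) (p ℤ.* u) q₀ R ⟩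
  frac (p ℤ.* v ℤ.* + R ℤ.+ p ℤ.* u ℤ.* + q₀) (q₀ ℕ.* R)             ≡⟨ cong (λ x → frac x (q₀ ℕ.* R)) numerator ⟩
  frac p (q₀ ℕ.* R)                                                  ∎)
  where
  open ≡-Reasoning
  q₀ R : ℕ
  q₀ = q zero
  R = ∏ (tail q)
  instance
    q₀≢0 : NonZero q₀
    q₀≢0 = q≢0 zero
    R≢0 : NonZero R
    R≢0 = ∏-nonZero (tail q) (q≢0 ∘ suc)
  factor : ∀ p u v q r → p ℤ.* v ℤ.* r ℤ.+ p ℤ.* u ℤ.* q ≡ p ℤ.* (u ℤ.* q ℤ.+ v ℤ.* r)
  factor = ℤ-Ring.solve-∀
  numerator : p ℤ.* v ℤ.* + R ℤ.+ p ℤ.* u ℤ.* + q₀ ≡ p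
  numerator = trans (factor p u v (+ q₀) (+ R)) (trans (cong (p ℤ.*_) bézout) (ℤ.*-identityʳ p))

sum-of-fractions-approx : ∀ k (q : Fin (suc k) → ℕ) (q≢0 : ∀ i → NonZero (q i)) →
                          (∀ {i j} → i <ᶠ j → Coprime (q i) (q j)) →
                          ∀ θ {ε} → frac (+ 2) (∏ q) ≤ ε →
                          ∃ λ (a : Fin (suc k) → ℤ) → DistLe (sumℚ (suc k) (λ i → frac (a i) (q i))) θ ε
sum-of-fractions-approx k q q≢0 q⊥q θ {ε} 2/∏q≤ε
  with approx-by-frac θ (∏ q) {{∏-nonZero q q≢0}}
... | p , dist with partial-fractions k q q≢0 q⊥q p
... | a , sum≡ = a , subst (λ S → DistLe S θ ε) (sym sum≡) (DistLe-mono {frac p (∏ q)} {θ} 2/∏q≤ε dist)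

m∣n! : ∀ {m n} .{{_ : NonZero m}} → m ≤ℕ n → m ∣ n !
m∣n! {suc m} m≤n = ∣-trans (m∣m*n (m !)) (m≤n⇒m!∣n! m≤n)

-- A common divisor d of both divides (x + e)(1 + xm) - x(1 + (x + e)m) = e, hence m, hence xm and 1.
coprime[1+xm,1+[x+e]m] : ∀ x e m → e ∣ m → Coprime (1 ℕ.+ x ℕ.* m) (1 ℕ.+ (x ℕ.+ e) ℕ.* m)
coprime[1+xm,1+[x+e]m] x e m e∣m {d} (d∣1+xm , d∣1+[x+e]m) = ∣1⇒≡1 d∣1
  where
  identity : ∀ x e m → (x ℕ.+ e) ℕ.* (1 ℕ.+ x ℕ.* m) ≡ x ℕ.* (1 ℕ.+ (x ℕ.+ e) ℕ.* m) ℕ.+ e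
  identity = ℕ-Ring.solve-∀
  d∣e : d ∣ e
  d∣e = ∣m+n∣m⇒∣n (subst (d ∣_) (identity x e m) (∣n⇒∣m*n (x ℕ.+ e) d∣1+xm)) (∣n⇒∣m*n x d∣1+[x+e]m)
  d∣1 : d ∣ 1
  d∣1 = ∣m+n∣m⇒∣n (subst (d ∣_) (ℕ.+-comm 1 (x ℕ.* m)) d∣1+xm) (∣n⇒∣m*n x (∣-trans d∣e e∣m))

module Moduli (k : ℕ) {{k≢0 : NonZero k}} where

  K : ℕ
  K = k ℕ.* k !

  instance
    K≢0 : NonZero K
    K≢0 = ℕ.m*n≢0 k (k !) {{k≢0}} {{k ℕ.!≢0}}

  -- The moduli for N = N′ + 1; step N′ is the largest multiple m of k! with k m ≤ N′.
  step : ℕ → ℕ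
  step N′ = k ! ℕ.* (N′ / K)

  q : ℕ → Fin k → ℕ
  q N′ i = 1 ℕ.+ suc (toℕ i) ℕ.* step N′

  q≢0 : ∀ N′ i → NonZero (q N′ i)
  q≢0 N′ i = _

  q-coprime : ∀ N′ {i j} → i <ᶠ j → Coprime (q N′ i) (q N′ j)
  q-coprime N′ {i} {j} i<j = subst (λ x → Coprime (q N′ i) (1 ℕ.+ x ℕ.* step N′)) (cong suc i+e≡j)
    (coprime[1+xm,1+[x+e]m] (suc (toℕ i)) e (step N′) (∣-trans e∣k! (m∣m*n (N′ / K))))
    where
    e : ℕ
    e = toℕ j ℕ.∸ toℕ i
    i+e≡j : toℕ i ℕ.+ e ≡ toℕ j
    i+e≡j = ℕ.m+[n∸m]≡n (ℕ.<⇒≤ i<j)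
    e∣k! : e ∣ k !
    e∣k! = m∣n! {{ℕ.>-nonZero (ℕ.m<n⇒0<n∸m i<j)}} (ℕ.≤-trans (ℕ.m∸n≤m (toℕ j) (toℕ i)) (ℕ.<⇒≤ (toℕ<n j)))

  q≤N : ∀ N′ i → q N′ i ≤ℕ suc N′
  q≤N N′ i = s≤s (begin
    suc (toℕ i) ℕ.* step N′     ≤⟨ ℕ.*-monoˡ-≤ (step N′) (toℕ<n i) ⟩
    k ℕ.* (k ! ℕ.* (N′ / K))    ≡⟨ ℕ.*-assoc k (k !) (N′ / K) ⟨
    K ℕ.* (N′ / K)              ≡⟨ ℕ.*-comm K (N′ / K) ⟩
    N′ / K ℕ.* K                ≤⟨ m/n*n≤m N′ K ⟩
    N′                          ∎)
    where open ℕ.≤-Reasoning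

  N≤Kq : ∀ N′ i → suc N′ ≤ℕ K ℕ.* q N′ i
  N≤Kq N′ i = begin
    suc N′                               ≡⟨ cong suc (m≡m%n+[m/n]*n N′ K) ⟩
    suc (N′ % K ℕ.+ N′ / K ℕ.* K)        ≤⟨ ℕ.+-monoˡ-≤ (N′ / K ℕ.* K) (m%n<n N′ K) ⟩
    K ℕ.+ N′ / K ℕ.* K                   ≡⟨ ℕ.*-comm (suc (N′ / K)) K ⟩
    K ℕ.* suc (N′ / K)                   ≤⟨ ℕ.*-monoʳ-≤ K (s≤s t≤[i+1]m) ⟩
    K ℕ.* q N′ i                         ∎
    where
    open ℕ.≤-Reasoning
    t≤[i+1]m : N′ / K ≤ℕ suc (toℕ i) ℕ.* step N′
    t≤[i+1]m = ℕ.≤-trans (ℕ.m≤n*m (N′ / K) (k !) {{k ℕ.!≢0}}) (ℕ.m≤n*m (step N′) (suc (toℕ i)))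

theorem2 : (k : ℕ) → 0 <ℕ k →
    Σ ℚ λ C → (0ℚ < C) ×
      ((θ : ℝ) (N : ℕ) → 0 <ℕ N →
        Σ (Fin k → ℤ) λ a → Σ (Fin k → ℕ) λ q →
          ((i : Fin k) → (1 ≤ℕ q i) × (q i ≤ℕ N)) ×
          DistLe (sumℚ k (λ i → frac (a i) (q i))) θ (C * frac (+ 1) (N ^ k)))
theorem2 (suc k) _ = C , frac-pos c 1 , λ where
    θ (suc N′) _ →
      let a , dist = sum-of-fractions-approx k (q N′) (q≢0 N′) (q-coprime N′) θ (budget N′)
      in  a , q N′ , (λ i → s≤s z≤n , q≤N N′ i) , dist
  where
  open Moduli (suc k)
  c : ℕ
  c = 2 ℕ.* K ^ suc k
  instance
    c≢0 : NonZero c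
    c≢0 = ℕ.m*n≢0 2 (K ^ suc k) {{_}} {{ℕ.m^n≢0 K (suc k)}}
  C : ℚ
  C = frac (+ c) 1
  budget : ∀ N′ → frac (+ 2) (∏ (q N′)) ≤ C * frac 1ℤ (suc N′ ^ suc k)
  budget N′ = P≤cQ⇒a/Q≤ac*1/P 2 (K ^ suc k) {{ℕ.m^n≢0 (suc N′) (suc k)}} {{∏-nonZero (q N′) (q≢0 N′)}}
                (n^k≤c^k*∏q {c = K} (q N′) (N≤Kq N′))
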